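{- Let $m\ge2$ and consider the $(q,m-1)$-Calkin-Wilf tree of order $m$. Let $j\geq0$ and let $v$ be the vertex of the $(m-1)$-st branch of the root obtained from the root by taking the $(m-1)$-st child $j$ times, whose label is $\frac{U_j\left(\frac{1}{2\sqrt{ -q}}\right)}{\sqrt{ -q}U_{j+1}\left(\frac{1}{2\sqrt{ -q}}\right)}$. Then the $(m-1)$-st branch of $v$ is $$B_{v,m-1}=\left\{\frac{U_i\left(\frac{1}{2\sqrt{ -q}}\right)}{\sqrt{ -q}\,U_{i+1}\left(\frac{1}{2\sqrt{ -q}}\right)}\right\}_{i\geq j}.$$ If $m\geq3$, then for each $k\in\{1,\dots,m-2\}$ the $k$-th branch of $v$ is $B_{v,k}=\{v,\,1/(1+q),\,1/(1+q),\,1/(1+q),\ldots\}$, and the $m$-th branch of $v$ is $B_{v,m}=\{v,\,1/(1+qt),\,1/(1+q+q^2t),\,1/(1+q+q^2+q^3t),\ldots\}$, where $t=\sqrt{ -q}^{\,j+1}U_{j+1}\left(\frac{1}{2\sqrt{ -q}}\right)$ (and the first entry of each branch denotes the label of $v$).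
   Context: For $m\ge3$, the $(q,m-1)$-Calkin-Wilf tree of order $m$ is the infinite complete $m$-ary rooted tree (ordered children: first, ..., $m$-th) with vertices labeled by rational functions of $q$, defined recursively: the root is labeled $\frac11$; for a vertex $v$ with label $\lambda(v)=\frac ab$, each of its first $m-2$ children is labeled $\frac1{1+q}$, its $(m-1)$-st child is labeled $\frac{b}{b+qa}$, and its $m$-th child is labeled $\frac{1}{1+qp\prod_{j=1}^{s}1/\lambda(v_j)}$, where $v_1=v$, $s\ge1$ is maximal such that there are vertices $v_2,\dots,v_s$ with $v_j$ the $(m-1)$-st child of $v_{j+1}$ for $j<s$, and $p=\lambda(v_{s+1})$ if $v_s$ is the $(m-2)$-nd child of a vertex $v_{s+1}$, $p=1$ otherwise. For $m=2$, the $(q,1)$-Calkin-Wilf tree of order $2$ is the binary tree with root labeled $\frac11$ in which the first child of a vertex labeled $\frac ab$ is labeled $\frac{b}{b+qa}$, and the second child is labeled by the same rule as the $m$-th child above, except that $p$ is defined as follows: list the vertices level by level, left to right, as $w_0,w_1,\dots$ (children of $w_n$ are $w_{2n+1},w_{2n+2}$); if $v_s$ is the second child of $w_{n'}$ then $p=\lambda(w_{n'+1})$, and $p=1$ otherwise. For a vertex $v$ and $k\in\{1,\dots,m\}$, the $k$-th branch $B_{v,k}$ of $v$ is the sequence of labels of the vertices $v_1=v,v_2,\ldots$ where $v_i$ is the $k$-th child of $v_{i-1}$ for $i\ge2$. $U_n$ are the Chebyshev polynomials of the second kind: $U_0(t)=1$, $U_1(t)=2t$, $U_n(t)=2tU_{n-1}(t)-U_{n-2}(t)$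 for $n\ge2$. -}

module Defs where

open import Data.Nat using (ℕ; zero; suc; _+_; _*_; _∸_; _<ᵇ_; _≡ᵇ_)
open import Data.Nat.DivMod using (_/_; _%_)
open import Data.Integer as ℤ using (ℤ; +_; 0ℤ; 1ℤ)
open import Data.List using (List; []; _∷_; map)
open import Data.List.Relation.Unary.All using (All)
open import Data.Bool using (Bool; true; false; if_then_else_)
open import Data.Product using (_×_; _,_; proj₁; proj₂)
open import Relation.Binary.PropositionalEquality using (_≡_)
open import Relation.Nullary using (¬_)

-- Polynomials over ℤ in one indeterminate X (coefficient lists,
-- lowest degree first).

Poly : Set
Poly = List ℤ

infixl 6 _+ₚ_ _-ₚ_
infixl 7 _*ₚ_

_+ₚ_ : Poly → Poly → Poly
[] +ₚ r = r
(a ∷ p) +ₚ [] = a ∷ p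
(a ∷ p) +ₚ (b ∷ r) = (a ℤ.+ b) ∷ (p +ₚ r)

scaleₚ : ℤ → Poly → Poly
scaleₚ a = map (a ℤ.*_)

_*ₚ_ : Poly → Poly → Poly
[] *ₚ r = []
(a ∷ p) *ₚ r = scaleₚ a r +ₚ (0ℤ ∷ (p *ₚ r))

negₚ : Poly → Poly
negₚ = map (λ a → ℤ.- a)

_-ₚ_ : Poly → Poly → Poly
p -ₚ r = p +ₚ negₚ r

oneₚ : Poly
oneₚ = 1ℤ ∷ []

Xₚ : Poly
Xₚ = 0ℤ ∷ 1ℤ ∷ []

IsZeroₚ : Poly → Set
IsZeroₚ p = All (_≡ 0ℤ) p

-- Elements of the field of fractions ℚ(X) of ℤ[X], as formal
-- quotients num/den.  Operations are the literal fraction formulas.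

record Frac : Set where
  constructor frac
  field
    num : Poly
    den : Poly

open Frac public

fromPoly : Poly → Frac
fromPoly p = frac p oneₚ

oneF : Frac
oneF = fromPoly oneₚ

infixl 6 _+F_ _-F_
infixl 7 _*F_ _÷F_

_+F_ : Frac → Frac → Frac
frac a b +F frac c d = frac (a *ₚ d +ₚ c *ₚ b) (b *ₚ d)

_*F_ : Frac → Frac → Frac
frac a b *F frac c d = frac (a *ₚ c) (b *ₚ d)

negF : Frac → Frac
negF (frac a b) = frac (negₚ a) b

_-F_ : Frac → Frac → Frac
x -F y = x +F negF y

invF : Frac → Frac
invF (frac a b) = frac b a

_÷F_ : Frac → Frac → Frac
x ÷F y = x *F invF y

_^F_ : Frac → ℕ → Frac
x ^F zero = oneF
x ^F suc n = x *F (x ^F n)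

infix 4 _≃_
_≃_ : Frac → Frac → Set
frac a b ≃ frac c d = ¬ IsZeroₚ b × ¬ IsZeroₚ d × IsZeroₚ (a *ₚ d -ₚ c *ₚ b)

chebU : ℕ → Frac → Frac
chebU zero x = oneF
chebU (suc zero) x = fromPoly (+ 2 ∷ []) *F x
chebU (suc (suc n)) x = fromPoly (+ 2 ∷ []) *F x *F chebU (suc n) x -F chebU n x

-- Vertices are numbered in level order w₀ (root), w₁, …; the
-- c-th child (c ∈ {1,…,m}) of w_n is w_{m·n + c}.  Thus the vertex
-- w_{suc n} is the ((n % m) + 1)-st child of w_{n / m}.
-- labelF is defined by recursion on a fuel argument; every recursive
-- call is on a vertex with smaller level-order index, so fuel
-- (index + 1) suffices (see `cwLabel`).

module Tree (k : ℕ) (q : Poly) where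

  m : ℕ
  m = suc (suc k)

  qF : Frac
  qF = fromPoly q

  -- label b/(b+qa) of the (m-1)-st child of a vertex labelled a/b
  cwStep : Frac → Frac
  cwStep (frac a b) = frac b (b +ₚ q *ₚ a)

  mutual
    labelF : ℕ → ℕ → Frac
    labelF zero n = oneF
    labelF (suc f) zero = oneF
    labelF (suc f) (suc n) = childLabel f (n % m) (n / m)

    -- label of the (pos+1)-st child of the vertex w_par
    childLabel : ℕ → ℕ → ℕ → Frac
    childLabel f pos par =
      if pos <ᵇ k then frac oneₚ (oneₚ +ₚ q)
      else if pos ≡ᵇ k then cwStep (labelF f par)
      else mthLabel f par

    -- climb u : goes up from v₁ = u while the current vertex is an
    -- (m-1)-st child; returns (∏ 1/λ(v_j), v_s)
    climb : ℕ → ℕ → ℕ → Frac × ℕ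
    climb f g zero = invF (labelF f zero) , zero
    climb f zero (suc u) = invF (labelF f (suc u)) , suc u
    climb f (suc g) (suc u) =
      if (u % m) ≡ᵇ k
      then (invF (labelF f (suc u)) *F proj₁ (climb f g (u / m)) , proj₂ (climb f g (u / m)))
      else (invF (labelF f (suc u)) , suc u)

    -- the value p, given the top vertex v_s of the chain
    pValue : ℕ → ℕ → Frac
    pValue f zero = oneF
    pValue f (suc t) = pk k
      where
      pk : ℕ → Frac
      -- m = 2: v_s is the second child of w_{n'} with n' = t / 2
      pk zero = if (t % m) ≡ᵇ 1 then labelF f (suc (t / m)) else oneF
      -- m ≥ 3: v_s is the (m-2)-nd child (0-based position k-1)
      pk (suc k') = if (t % m) ≡ᵇ k' then labelF f (t / m) else oneF

    mthLabel : ℕ → ℕ → Frac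
    mthLabel f v = invF (oneF +F qF *F pValue f (proj₂ (climb f (suc f) v)) *F proj₁ (climb f (suc f) v))

  label : ℕ → Frac
  label n = labelF (suc n) n

-- Label of vertex w_n of the (q,m-1)-Calkin–Wilf tree of order m
-- (meaningful for m ≥ 2 only).
cwLabel : ℕ → Poly → ℕ → Frac
cwLabel zero q n = oneF
cwLabel (suc zero) q n = oneF
cwLabel (suc (suc k)) q n = Tree.label k q n

child : ℕ → ℕ → ℕ → ℕ
child m c v = m * v + c

iter : (ℕ → ℕ) → ℕ → ℕ → ℕ
iter h zero x = x
iter h (suc i) x = h (iter h i x)

-- Working in ℚ(s) with s = √(-q):  X plays the role of s, and q = -s².

sF : Frac
sF = fromPoly Xₚ

qₛ : Poly
qₛ = negₚ (Xₚ *ₚ Xₚ)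

qsF : Frac
qsF = fromPoly qₛ

xₛ : Frac
xₛ = frac oneₚ (+ 2 ∷ []) ÷F sF

ratioU : ℕ → Frac
ratioU i = chebU i xₛ ÷F (sF *F chebU (suc i) xₛ)

tVal : ℕ → Frac
tVal j = (sF ^F suc j) *F chebU (suc j) xₛ

geomF : ℕ → Frac
geomF zero = fromPoly []
geomF (suc i) = geomF i +F (qsF ^F i)

-- Along the (m-1)-st branch of the root every step is a/b ↦ b/(b + q a), so the labels
-- are f_j / f_{j+1} with f_0 = f_1 = 1 and f_{n+2} = f_{n+1} + q f_n.  Writing q = -s²,
-- the polynomials s^n U_n(1/(2s)) obey the same recurrence, hence equal f_n,
-- which gives the first claim.  The first m-2 children of any vertex are labelled
-- 1/(1+q).  For the m-th child of the vertex v the climb in the m-th child rule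
-- runs up to the root, so p = 1 and the product of reciprocal labels telescopes to
-- f_{j+1} = t; every later vertex of the m-th branch of v is an m-th child, so the
-- climb stops at once, again p = 1, and the reciprocal labels follow r ↦ 1 + q r.
-- Identities in ℚ(s) are checked by cross-multiplying fractions over ℤ[s]; chaining
-- them needs cancellation, i.e. that ℤ[s] is an integral domain.

module Submission where

open import Defs
open import Data.Nat using (ℕ; zero; suc; _+_; _∸_; _≤_)
open import Data.Product using (_×_)

open import Algebra.Bundles using (CommutativeRing)
import Algebra.Properties.CommutativeSemigroup as CommutativeSemigroupProperties
open import Data.Bool using (true; false; if_then_else_; T)
open import Data.Empty using (⊥-elim)
open import Data.Integer as ℤ using (ℤ; +_; 0ℤ; 1ℤ)
import Data.Integer.Properties as ℤ
open import Data.List using ([]; _∷_)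
open import Data.List.Relation.Unary.All using ([]; _∷_)
open import Data.Maybe using (nothing)
open import Data.Nat using (_*_; _<_; s≤s; _<ᵇ_; _≡ᵇ_)
open import Data.Nat.DivMod
  using (_/_; _%_; [m+kn]%n≡m%n; m<n⇒m%n≡m; +-distrib-/-∣ˡ; m*n/n≡m; m<n⇒m/n≡0)
open import Data.Nat.Divisibility using (divides-refl)
open import Data.Nat.Properties
  using (+-suc; +-comm; *-comm; +-identityʳ; m≤m+n; ≤-refl; ≤-trans; <⇒≤; m≤n⇒m≤1+n; n<1+n; n≤1+n;
         +-monoʳ-≤; <-trans; <⇒≱; >⇒≢; 1+n≢n; <⇒<ᵇ; <ᵇ⇒<; ≡⇒≡ᵇ; ≡ᵇ⇒≡)
open import Data.Product using (_,_; proj₁; proj₂)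
open import Data.Sum as Sum using (_⊎_; inj₁; inj₂)
open import Function using (id)
open import Relation.Binary.Bundles using (Setoid)
open import Relation.Binary.PropositionalEquality
  using (_≡_; _≢_; refl; sym; trans; cong; cong₂; subst; module ≡-Reasoning)
import Relation.Binary.Reasoning.Setoid as SetoidReasoning
open import Relation.Binary.Structures using (IsEquivalence)
open import Relation.Nullary using (¬_; yes; no)
open import Relation.Nullary.Negation using (contradiction)
open import Tactic.RingSolver using (solve-∀)
import Tactic.RingSolver.Core.AlmostCommutativeRing as ACR

open CommutativeSemigroupProperties ℤ.+-commutativeSemigroup
  using () renaming (interchange to +-interchange; x∙yz≈y∙xz to +-leftComm)

-- ℤ[X] as a commutative ring and an integral domain

coeff : Poly → ℕ → ℤ
coeff [] _ = 0ℤ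
coeff (a ∷ p) zero = a
coeff (a ∷ p) (suc n) = coeff p n

-- Coefficient lists are compared up to trailing zeros.
infix 4 _≈_
record _≈_ (p r : Poly) : Set where
  field coeff-≡ : ∀ n → coeff p n ≡ coeff r n
open _≈_

≈-refl : ∀ {p} → p ≈ p
≈-refl .coeff-≡ n = refl

≈-sym : ∀ {p r} → p ≈ r → r ≈ p
≈-sym e .coeff-≡ n = sym (coeff-≡ e n)

≈-trans : ∀ {p r s} → p ≈ r → r ≈ s → p ≈ s
≈-trans e f .coeff-≡ n = trans (coeff-≡ e n) (coeff-≡ f n)

≈-isEquivalence : IsEquivalence _≈_
≈-isEquivalence = record { refl = ≈-refl ; sym = ≈-sym ; trans = ≈-trans }

≈-setoid : Setoid _ _
≈-setoid = record { isEquivalence = ≈-isEquivalence }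

module ≈-Reasoning = SetoidReasoning ≈-setoid

∷-cong : ∀ {a b p r} → a ≡ b → p ≈ r → a ∷ p ≈ b ∷ r
∷-cong a≡b p≈r .coeff-≡ zero = a≡b
∷-cong a≡b p≈r .coeff-≡ (suc n) = coeff-≡ p≈r n

∷-injectiveʳ : ∀ {a b p r} → a ∷ p ≈ b ∷ r → p ≈ r
∷-injectiveʳ e .coeff-≡ n = coeff-≡ e (suc n)

∷-≈[]ʳ : ∀ {a p} → a ∷ p ≈ [] → p ≈ []
∷-≈[]ʳ e .coeff-≡ n = coeff-≡ e (suc n)

∷-≈[] : ∀ {a p} → a ≡ 0ℤ → p ≈ [] → a ∷ p ≈ []
∷-≈[] a≡0 e .coeff-≡ zero = a≡0
∷-≈[] a≡0 e .coeff-≡ (suc n) = coeff-≡ e n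

coeff-+ : ∀ p r n → coeff (p +ₚ r) n ≡ coeff p n ℤ.+ coeff r n
coeff-+ [] r n = sym (ℤ.+-identityˡ _)
coeff-+ (a ∷ p) [] n = sym (ℤ.+-identityʳ _)
coeff-+ (a ∷ p) (b ∷ r) zero = refl
coeff-+ (a ∷ p) (b ∷ r) (suc n) = coeff-+ p r n

coeff-scale : ∀ a p n → coeff (scaleₚ a p) n ≡ a ℤ.* coeff p n
coeff-scale a [] n = sym (ℤ.*-zeroʳ a)
coeff-scale a (b ∷ p) zero = refl
coeff-scale a (b ∷ p) (suc n) = coeff-scale a p n

coeff-neg : ∀ p n → coeff (negₚ p) n ≡ ℤ.- coeff p n
coeff-neg [] n = refl
coeff-neg (b ∷ p) zero = refl
coeff-neg (b ∷ p) (suc n) = coeff-neg p n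

+ₚ-cong : ∀ {p p′ r r′} → p ≈ p′ → r ≈ r′ → p +ₚ r ≈ p′ +ₚ r′
+ₚ-cong {p} {p′} {r} {r′} e f .coeff-≡ n
  rewrite coeff-+ p r n | coeff-+ p′ r′ n = cong₂ ℤ._+_ (coeff-≡ e n) (coeff-≡ f n)

negₚ-cong : ∀ {p p′} → p ≈ p′ → negₚ p ≈ negₚ p′
negₚ-cong {p} {p′} e .coeff-≡ n rewrite coeff-neg p n | coeff-neg p′ n = cong ℤ.-_ (coeff-≡ e n)

+ₚ-assoc : ∀ p r s → (p +ₚ r) +ₚ s ≈ p +ₚ (r +ₚ s)
+ₚ-assoc p r s .coeff-≡ n
  rewrite coeff-+ (p +ₚ r) s n | coeff-+ p r n | coeff-+ p (r +ₚ s) n | coeff-+ r s n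
  = ℤ.+-assoc (coeff p n) (coeff r n) (coeff s n)

+ₚ-comm : ∀ p r → p +ₚ r ≈ r +ₚ p
+ₚ-comm p r .coeff-≡ n rewrite coeff-+ p r n | coeff-+ r p n = ℤ.+-comm (coeff p n) (coeff r n)

+ₚ-identityʳ : ∀ p → p +ₚ [] ≈ p
+ₚ-identityʳ p .coeff-≡ n rewrite coeff-+ p [] n = ℤ.+-identityʳ (coeff p n)

+ₚ-inverseˡ : ∀ p → negₚ p +ₚ p ≈ []
+ₚ-inverseˡ p .coeff-≡ n rewrite coeff-+ (negₚ p) p n | coeff-neg p n = ℤ.+-inverseˡ (coeff p n)

+ₚ-inverseʳ : ∀ p → p +ₚ negₚ p ≈ []
+ₚ-inverseʳ p .coeff-≡ n rewrite coeff-+ p (negₚ p) n | coeff-neg p n = ℤ.+-inverseʳ (coeff p n)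

+ₚ-interchange : ∀ a b c d → (a +ₚ b) +ₚ (c +ₚ d) ≈ (a +ₚ c) +ₚ (b +ₚ d)
+ₚ-interchange a b c d .coeff-≡ n
  rewrite coeff-+ (a +ₚ b) (c +ₚ d) n | coeff-+ (a +ₚ c) (b +ₚ d) n
        | coeff-+ a b n | coeff-+ c d n | coeff-+ a c n | coeff-+ b d n
  = +-interchange (coeff a n) (coeff b n) (coeff c n) (coeff d n)

+ₚ-leftComm : ∀ a b c → a +ₚ (b +ₚ c) ≈ b +ₚ (a +ₚ c)
+ₚ-leftComm a b c .coeff-≡ n
  rewrite coeff-+ a (b +ₚ c) n | coeff-+ b (a +ₚ c) n | coeff-+ b c n | coeff-+ a c n
  = +-leftComm (coeff a n) (coeff b n) (coeff c n)

scaleₚ-distribʳ : ∀ a b r → scaleₚ (a ℤ.+ b) r ≈ scaleₚ a r +ₚ scaleₚ b r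
scaleₚ-distribʳ a b r .coeff-≡ n
  rewrite coeff-+ (scaleₚ a r) (scaleₚ b r) n | coeff-scale (a ℤ.+ b) r n
        | coeff-scale a r n | coeff-scale b r n
  = ℤ.*-distribʳ-+ (coeff r n) a b

scaleₚ-distribˡ : ∀ a r s → scaleₚ a (r +ₚ s) ≈ scaleₚ a r +ₚ scaleₚ a s
scaleₚ-distribˡ a r s .coeff-≡ n
  rewrite coeff-+ (scaleₚ a r) (scaleₚ a s) n | coeff-scale a (r +ₚ s) n
        | coeff-+ r s n | coeff-scale a r n | coeff-scale a s n
  = ℤ.*-distribˡ-+ a (coeff r n) (coeff s n)

scaleₚ-assoc : ∀ a b r → scaleₚ a (scaleₚ b r) ≈ scaleₚ (a ℤ.* b) r
scaleₚ-assoc a b r .coeff-≡ n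
  rewrite coeff-scale a (scaleₚ b r) n | coeff-scale b r n | coeff-scale (a ℤ.* b) r n
  = sym (ℤ.*-assoc a b (coeff r n))

scaleₚ-identity : ∀ r → scaleₚ 1ℤ r ≈ r
scaleₚ-identity r .coeff-≡ n rewrite coeff-scale 1ℤ r n = ℤ.*-identityˡ (coeff r n)

scaleₚ-zero : ∀ {a} r → a ≡ 0ℤ → scaleₚ a r ≈ []
scaleₚ-zero r refl .coeff-≡ n rewrite coeff-scale 0ℤ r n = refl

scaleₚ-0∷ : ∀ a r → scaleₚ a (0ℤ ∷ r) ≈ 0ℤ ∷ scaleₚ a r
scaleₚ-0∷ a r = ∷-cong (ℤ.*-zeroʳ a) ≈-refl

coeff₀-* : ∀ p r → coeff (p *ₚ r) 0 ≡ coeff p 0 ℤ.* coeff r 0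
coeff₀-* [] r = refl
coeff₀-* (a ∷ p) r =
  trans (coeff-+ (scaleₚ a r) (0ℤ ∷ p *ₚ r) 0) (trans (ℤ.+-identityʳ _) (coeff-scale a r 0))

*ₚ-∷ˡ-zero : ∀ {a} p r → a ≡ 0ℤ → (a ∷ p) *ₚ r ≈ 0ℤ ∷ p *ₚ r
*ₚ-∷ˡ-zero p r a≡0 = +ₚ-cong (scaleₚ-zero r a≡0) ≈-refl

*ₚ-≈[]ˡ : ∀ {p} r → p ≈ [] → p *ₚ r ≈ []
*ₚ-≈[]ˡ {[]} r e = ≈-refl
*ₚ-≈[]ˡ {b ∷ p} r e =
  +ₚ-cong (scaleₚ-zero r (coeff-≡ e 0)) (∷-≈[] refl (*ₚ-≈[]ˡ r (∷-≈[]ʳ e)))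

*ₚ-congˡ : ∀ {p p′} r → p ≈ p′ → p *ₚ r ≈ p′ *ₚ r
*ₚ-congˡ {[]} r e = ≈-sym (*ₚ-≈[]ˡ r (≈-sym e))
*ₚ-congˡ {a ∷ p} {[]} r e = *ₚ-≈[]ˡ r e
*ₚ-congˡ {a ∷ p} {b ∷ p′} r e rewrite coeff-≡ e 0 =
  +ₚ-cong ≈-refl (∷-cong refl (*ₚ-congˡ r (∷-injectiveʳ e)))

*ₚ-zeroʳ : ∀ p → p *ₚ [] ≈ []
*ₚ-zeroʳ [] = ≈-refl
*ₚ-zeroʳ (a ∷ p) = ∷-≈[] refl (*ₚ-zeroʳ p)

*ₚ-∷ʳ : ∀ p b r → p *ₚ (b ∷ r) ≈ scaleₚ b p +ₚ (0ℤ ∷ p *ₚ r)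
*ₚ-∷ʳ [] b r = ≈-sym (∷-≈[] refl ≈-refl)
*ₚ-∷ʳ (a ∷ p) b r = ∷-cong (cong (ℤ._+ 0ℤ) (ℤ.*-comm a b))
  (≈-trans (+ₚ-cong ≈-refl (*ₚ-∷ʳ p b r))
           (+ₚ-leftComm (scaleₚ a r) (scaleₚ b p) (0ℤ ∷ p *ₚ r)))

*ₚ-comm : ∀ p r → p *ₚ r ≈ r *ₚ p
*ₚ-comm [] r = ≈-sym (*ₚ-zeroʳ r)
*ₚ-comm (a ∷ p) r = ≈-sym (≈-trans (*ₚ-∷ʳ r a p) (+ₚ-cong ≈-refl (∷-cong refl (*ₚ-comm r p))))

*ₚ-distribʳ : ∀ r p p′ → (p +ₚ p′) *ₚ r ≈ p *ₚ r +ₚ p′ *ₚ r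
*ₚ-distribʳ r [] p′ = ≈-refl
*ₚ-distribʳ r (a ∷ p) [] = ≈-sym (+ₚ-identityʳ _)
*ₚ-distribʳ r (a ∷ p) (b ∷ p′) =
  ≈-trans (+ₚ-cong (scaleₚ-distribʳ a b r) (∷-cong refl (*ₚ-distribʳ r p p′)))
          (+ₚ-interchange (scaleₚ a r) (scaleₚ b r) (0ℤ ∷ p *ₚ r) (0ℤ ∷ p′ *ₚ r))

scaleₚ-*ₚ : ∀ a r s → scaleₚ a r *ₚ s ≈ scaleₚ a (r *ₚ s)
scaleₚ-*ₚ a [] s = ≈-refl
scaleₚ-*ₚ a (b ∷ r) s = ≈-sym (begin
  scaleₚ a (scaleₚ b s +ₚ (0ℤ ∷ r *ₚ s))
    ≈⟨ scaleₚ-distribˡ a (scaleₚ b s) (0ℤ ∷ r *ₚ s) ⟩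
  scaleₚ a (scaleₚ b s) +ₚ scaleₚ a (0ℤ ∷ r *ₚ s)
    ≈⟨ +ₚ-cong (scaleₚ-assoc a b s) (scaleₚ-0∷ a (r *ₚ s)) ⟩
  scaleₚ (a ℤ.* b) s +ₚ (0ℤ ∷ scaleₚ a (r *ₚ s))
    ≈⟨ +ₚ-cong ≈-refl (∷-cong refl (≈-sym (scaleₚ-*ₚ a r s))) ⟩
  scaleₚ (a ℤ.* b) s +ₚ (0ℤ ∷ scaleₚ a r *ₚ s)
    ∎)
  where open ≈-Reasoning

*ₚ-assoc : ∀ p r s → (p *ₚ r) *ₚ s ≈ p *ₚ (r *ₚ s)
*ₚ-assoc [] r s = ≈-refl
*ₚ-assoc (a ∷ p) r s =
  ≈-trans (*ₚ-distribʳ s (scaleₚ a r) (0ℤ ∷ p *ₚ r))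
          (+ₚ-cong (scaleₚ-*ₚ a r s)
                   (≈-trans (*ₚ-∷ˡ-zero (p *ₚ r) s refl) (∷-cong refl (*ₚ-assoc p r s))))

*ₚ-identityˡ : ∀ p → oneₚ *ₚ p ≈ p
*ₚ-identityˡ p = ≈-trans (+ₚ-cong (scaleₚ-identity p) (∷-≈[] refl ≈-refl)) (+ₚ-identityʳ p)

*ₚ-cong : ∀ {p p′ r r′} → p ≈ p′ → r ≈ r′ → p *ₚ r ≈ p′ *ₚ r′
*ₚ-cong {p′ = p′} {r} {r′} e f =
  ≈-trans (*ₚ-congˡ r e) (≈-trans (*ₚ-comm p′ r) (≈-trans (*ₚ-congˡ p′ f) (*ₚ-comm r′ p′)))

ℤ[X] : CommutativeRing _ _
ℤ[X] = record
  { Carrier = Poly ; _≈_ = _≈_ ; _+_ = _+ₚ_ ; _*_ = _*ₚ_ ; -_ = negₚ ; 0# = [] ; 1# = oneₚ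
  ; isCommutativeRing = record
    { isRing = record
      { +-isAbelianGroup = record
        { isGroup = record
          { isMonoid = record
            { isSemigroup = record
              { isMagma = record { isEquivalence = ≈-isEquivalence ; ∙-cong = +ₚ-cong }
              ; assoc = +ₚ-assoc }
            ; identity = (λ _ → ≈-refl) , +ₚ-identityʳ }
          ; inverse = +ₚ-inverseˡ , +ₚ-inverseʳ
          ; ⁻¹-cong = negₚ-cong }
        ; comm = +ₚ-comm }
      ; *-cong = *ₚ-cong
      ; *-assoc = *ₚ-assoc
      ; *-identity = *ₚ-identityˡ , λ p → ≈-trans (*ₚ-comm p oneₚ) (*ₚ-identityˡ p)
      ; distrib = (λ r p p′ → ≈-trans (*ₚ-comm r (p +ₚ p′))
                               (≈-trans (*ₚ-distribʳ r p p′) (+ₚ-cong (*ₚ-comm p r) (*ₚ-comm p′ r))))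
                , *ₚ-distribʳ }
    ; *-comm = *ₚ-comm } }

ℤ[X]-almost : ACR.AlmostCommutativeRing _ _
ℤ[X]-almost = ACR.fromCommutativeRing ℤ[X] (λ _ → nothing)

open CommutativeSemigroupProperties (CommutativeRing.*-commutativeSemigroup ℤ[X])
  using (xy∙z≈xz∙y) renaming (interchange to *ₚ-interchange)

Nonzero : Poly → Set
Nonzero p = ¬ (p ≈ [])

nonzero-at : ∀ {p} n → coeff p n ≢ 0ℤ → Nonzero p
nonzero-at n c e = c (coeff-≡ e n)

coeff₀-one⇒nonzero : ∀ {p} → coeff p 0 ≡ 1ℤ → Nonzero p
coeff₀-one⇒nonzero c = nonzero-at 0 λ c≡0 → 1≢0 (trans (sym c) c≡0)
  where
  1≢0 : 1ℤ ≢ 0ℤ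
  1≢0 ()

oneₚ-nonzero : Nonzero oneₚ
oneₚ-nonzero = coeff₀-one⇒nonzero refl

IsZero⇒≈[] : ∀ {p} → IsZeroₚ p → p ≈ []
IsZero⇒≈[] [] = ≈-refl
IsZero⇒≈[] (a≡0 ∷ p≡0) = ∷-≈[] a≡0 (IsZero⇒≈[] p≡0)

≈[]⇒IsZero : ∀ {p} → p ≈ [] → IsZeroₚ p
≈[]⇒IsZero {[]} e = []
≈[]⇒IsZero {a ∷ p} e = coeff-≡ e 0 ∷ ≈[]⇒IsZero (∷-≈[]ʳ e)

*ₚ-∷ʳ-zero : ∀ p {b r} → b ≡ 0ℤ → p *ₚ (b ∷ r) ≈ 0ℤ ∷ p *ₚ r
*ₚ-∷ʳ-zero p {b} {r} b≡0 = ≈-trans (*ₚ-∷ʳ p b r) (+ₚ-cong (scaleₚ-zero p b≡0) ≈-refl)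

*ₚ-head-zero : ∀ {a} p → a ≢ 0ℤ → ∀ r → (a ∷ p) *ₚ r ≈ [] → r ≈ []
*ₚ-head-zero p a≢0 [] e = ≈-refl
*ₚ-head-zero {a} p a≢0 (b ∷ r) e =
  ∷-≈[] b≡0 (*ₚ-head-zero p a≢0 r (∷-≈[]ʳ (≈-trans (≈-sym (*ₚ-∷ʳ-zero (a ∷ p) b≡0)) e)))
  where
  b≡0 : b ≡ 0ℤ
  b≡0 = Sum.[ (λ a≡0 → contradiction a≡0 a≢0) , id ]′
          (ℤ.i*j≡0⇒i≡0∨j≡0 a (trans (sym (ℤ.+-identityʳ _)) (coeff-≡ e 0)))

zero-product : ∀ p r → p *ₚ r ≈ [] → p ≈ [] ⊎ r ≈ []
zero-product [] r _ = inj₁ ≈-refl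
zero-product (a ∷ p) r e with a ℤ.≟ 0ℤ
... | yes a≡0 =
  Sum.map₁ (∷-≈[] a≡0) (zero-product p r (∷-≈[]ʳ (≈-trans (≈-sym (*ₚ-∷ˡ-zero p r a≡0)) e)))
... | no a≢0 = inj₂ (*ₚ-head-zero p a≢0 r e)

*ₚ-nonzero : ∀ {p r} → Nonzero p → Nonzero r → Nonzero (p *ₚ r)
*ₚ-nonzero {p} {r} p≉0 r≉0 e = Sum.[ p≉0 , r≉0 ]′ (zero-product p r e)

*ₚ-cancelʳ : ∀ {x y d} → Nonzero d → x *ₚ d ≈ y *ₚ d → x ≈ y
*ₚ-cancelʳ {x} {y} {d} d≉0 xd≈yd =
  Sum.[ x≈y , (λ d≈[] → contradiction d≈[] d≉0) ]′ (zero-product (x -ₚ y) d [x-y]d≈[])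
  where
  open ≈-Reasoning
  *ₚ-distribʳ-minus : ∀ x y d → (x -ₚ y) *ₚ d ≈ x *ₚ d -ₚ y *ₚ d
  *ₚ-distribʳ-minus = solve-∀ ℤ[X]-almost
  [x-y]d≈[] : (x -ₚ y) *ₚ d ≈ []
  [x-y]d≈[] = begin
    (x -ₚ y) *ₚ d       ≈⟨ *ₚ-distribʳ-minus x y d ⟩
    x *ₚ d -ₚ y *ₚ d    ≈⟨ +ₚ-cong xd≈yd ≈-refl ⟩
    y *ₚ d -ₚ y *ₚ d    ≈⟨ +ₚ-inverseʳ (y *ₚ d) ⟩
    []                  ∎
  x≈y : x -ₚ y ≈ [] → x ≈ y
  x≈y x-y≈[] = begin
    x                   ≈⟨ ≈-sym (+ₚ-identityʳ x) ⟩
    x +ₚ []             ≈⟨ +ₚ-cong ≈-refl (≈-sym (+ₚ-inverseˡ y)) ⟩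
    x +ₚ (negₚ y +ₚ y)  ≈⟨ ≈-sym (+ₚ-assoc x (negₚ y) y) ⟩
    (x -ₚ y) +ₚ y       ≈⟨ +ₚ-cong x-y≈[] ≈-refl ⟩
    y                   ∎

-- Fractions

-- The equality _≃_ of ℚ(X) without its side conditions on the denominators.
infix 4 _~_
record _~_ (x y : Frac) : Set where
  constructor mk~
  field cross : num x *ₚ den y ≈ num y *ₚ den x
open _~_

WellFormed : Frac → Set
WellFormed x = Nonzero (den x)

~-refl : ∀ {x} → x ~ x
~-refl = mk~ ≈-refl

~-sym : ∀ {x y} → x ~ y → y ~ x
~-sym x~y = mk~ (≈-sym (cross x~y))

~-trans : ∀ {x y z} → WellFormed y → x ~ y → y ~ z → x ~ z
~-trans {frac a b} {frac c d} {frac e f} d≉0 (mk~ ad≈cb) (mk~ cf≈ed) = mk~ (*ₚ-cancelʳ d≉0 (begin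
  (a *ₚ f) *ₚ d   ≈⟨ xy∙z≈xz∙y a f d ⟩
  (a *ₚ d) *ₚ f   ≈⟨ *ₚ-cong ad≈cb ≈-refl ⟩
  (c *ₚ b) *ₚ f   ≈⟨ xy∙z≈xz∙y c b f ⟩
  (c *ₚ f) *ₚ b   ≈⟨ *ₚ-cong cf≈ed ≈-refl ⟩
  (e *ₚ d) *ₚ b   ≈⟨ xy∙z≈xz∙y e d b ⟩
  (e *ₚ b) *ₚ d   ∎))
  where open ≈-Reasoning

+F-cong : ∀ {x x′ y y′} → x ~ x′ → y ~ y′ → x +F y ~ x′ +F y′
+F-cong {frac a b} {frac a′ b′} {frac c d} {frac c′ d′} (mk~ ab′≈a′b) (mk~ cd′≈c′d) = mk~ (begin
  (a *ₚ d +ₚ c *ₚ b) *ₚ (b′ *ₚ d′)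
    ≈⟨ expand a b′ d d′ c b ⟩
  (a *ₚ b′) *ₚ (d *ₚ d′) +ₚ (c *ₚ d′) *ₚ (b *ₚ b′)
    ≈⟨ +ₚ-cong (*ₚ-cong ab′≈a′b ≈-refl) (*ₚ-cong cd′≈c′d ≈-refl) ⟩
  (a′ *ₚ b) *ₚ (d *ₚ d′) +ₚ (c′ *ₚ d) *ₚ (b *ₚ b′)
    ≈⟨ collect a′ b d d′ c′ b′ ⟩
  (a′ *ₚ d′ +ₚ c′ *ₚ b′) *ₚ (b *ₚ d)
    ∎)
  where
  open ≈-Reasoning
  expand : ∀ a b′ d d′ c b →
    (a *ₚ d +ₚ c *ₚ b) *ₚ (b′ *ₚ d′) ≈ (a *ₚ b′) *ₚ (d *ₚ d′) +ₚ (c *ₚ d′) *ₚ (b *ₚ b′)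
  expand = solve-∀ ℤ[X]-almost
  collect : ∀ a′ b d d′ c′ b′ →
    (a′ *ₚ b) *ₚ (d *ₚ d′) +ₚ (c′ *ₚ d) *ₚ (b *ₚ b′) ≈ (a′ *ₚ d′ +ₚ c′ *ₚ b′) *ₚ (b *ₚ d)
  collect = solve-∀ ℤ[X]-almost

*F-cong : ∀ {x x′ y y′} → x ~ x′ → y ~ y′ → x *F y ~ x′ *F y′
*F-cong {frac a b} {frac a′ b′} {frac c d} {frac c′ d′} (mk~ ab′≈a′b) (mk~ cd′≈c′d) = mk~ (begin
  (a *ₚ c) *ₚ (b′ *ₚ d′)   ≈⟨ *ₚ-interchange a c b′ d′ ⟩
  (a *ₚ b′) *ₚ (c *ₚ d′)   ≈⟨ *ₚ-cong ab′≈a′b cd′≈c′d ⟩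
  (a′ *ₚ b) *ₚ (c′ *ₚ d)   ≈⟨ *ₚ-interchange a′ b c′ d ⟩
  (a′ *ₚ c′) *ₚ (b *ₚ d)   ∎)
  where open ≈-Reasoning

negF-cong : ∀ {x x′} → x ~ x′ → negF x ~ negF x′
negF-cong {frac a b} {frac a′ b′} (mk~ ab′≈a′b) =
  mk~ (≈-trans (-‿*-distribˡ a b′) (≈-trans (negₚ-cong ab′≈a′b) (≈-sym (-‿*-distribˡ a′ b))))
  where
  -‿*-distribˡ : ∀ a b → negₚ a *ₚ b ≈ negₚ (a *ₚ b)
  -‿*-distribˡ = solve-∀ ℤ[X]-almost

invF-cong : ∀ {x x′} → x ~ x′ → invF x ~ invF x′
invF-cong {frac a b} {frac a′ b′} (mk~ ab′≈a′b) =
  mk~ (≈-trans (*ₚ-comm b a′) (≈-trans (≈-sym ab′≈a′b) (*ₚ-comm a b′)))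

-F-cong : ∀ {x x′ y y′} → x ~ x′ → y ~ y′ → x -F y ~ x′ -F y′
-F-cong x~x′ y~y′ = +F-cong x~x′ (negF-cong y~y′)

^F-wellFormed : ∀ {x} n → WellFormed x → WellFormed (x ^F n)
^F-wellFormed zero _ = oneₚ-nonzero
^F-wellFormed (suc n) wf = *ₚ-nonzero wf (^F-wellFormed n wf)

~⇒≃ : ∀ {x y} → WellFormed x → WellFormed y → x ~ y → x ≃ y
~⇒≃ {frac a b} {frac c d} b≉0 d≉0 (mk~ ad≈cb) =
  (λ b≡0 → b≉0 (IsZero⇒≈[] b≡0)) , (λ d≡0 → d≉0 (IsZero⇒≈[] d≡0)) ,
  ≈[]⇒IsZero (≈-trans (+ₚ-cong ad≈cb ≈-refl) (+ₚ-inverseʳ (c *ₚ b)))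

~-num-nonzero : ∀ {x y} → x ~ y → WellFormed x → Nonzero (num y) → Nonzero (num x)
~-num-nonzero {x} {y} x~y wf y≉0 x≈0 =
  *ₚ-nonzero y≉0 wf (≈-trans (≈-sym (cross x~y)) (*ₚ-≈[]ˡ (den y) x≈0))

infixr 8 _^ₚ_
_^ₚ_ : Poly → ℕ → Poly
p ^ₚ zero = oneₚ
p ^ₚ suc n = p *ₚ p ^ₚ n

fib : Poly → ℕ → Poly
fib q zero = oneₚ
fib q (suc zero) = oneₚ
fib q (suc (suc n)) = fib q (suc n) +ₚ q *ₚ fib q n

geomₚ : Poly → ℕ → Poly
geomₚ q zero = []
geomₚ q (suc i) = geomₚ q i +ₚ q ^ₚ i

^ₚ-nonzero : ∀ {p} n → Nonzero p → Nonzero (p ^ₚ n)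
^ₚ-nonzero zero _ = oneₚ-nonzero
^ₚ-nonzero (suc n) p≉0 = *ₚ-nonzero p≉0 (^ₚ-nonzero n p≉0)

geomₚ-suc : ∀ q i → geomₚ q (suc i) ≈ oneₚ +ₚ q *ₚ geomₚ q i
geomₚ-suc q zero = ≈-sym (+ₚ-cong ≈-refl (*ₚ-zeroʳ q))
geomₚ-suc q (suc i) = ≈-trans (+ₚ-cong (geomₚ-suc q i) ≈-refl) (distrib q (geomₚ q i) (q ^ₚ i))
  where
  distrib : ∀ q g r → (oneₚ +ₚ q *ₚ g) +ₚ q *ₚ r ≈ oneₚ +ₚ q *ₚ (g +ₚ r)
  distrib = solve-∀ ℤ[X]-almost

fromPoly-cong : ∀ {p r} → p ≈ r → fromPoly p ~ fromPoly r
fromPoly-cong p≈r = mk~ (*ₚ-cong p≈r ≈-refl)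

fromPoly-+ : ∀ p r → fromPoly p +F fromPoly r ~ fromPoly (p +ₚ r)
fromPoly-+ p r = mk~ (clear-denominators p r)
  where
  clear-denominators : ∀ p r → (p *ₚ oneₚ +ₚ r *ₚ oneₚ) *ₚ oneₚ ≈ (p +ₚ r) *ₚ (oneₚ *ₚ oneₚ)
  clear-denominators = solve-∀ ℤ[X]-almost

fromPoly-* : ∀ p r → fromPoly p *F fromPoly r ~ fromPoly (p *ₚ r)
fromPoly-* p r = mk~ (clear-denominators p r)
  where
  clear-denominators : ∀ p r → (p *ₚ r) *ₚ oneₚ ≈ (p *ₚ r) *ₚ (oneₚ *ₚ oneₚ)
  clear-denominators = solve-∀ ℤ[X]-almost

fromPoly-^ : ∀ p n → fromPoly p ^F n ~ fromPoly (p ^ₚ n)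
fromPoly-^ p zero = ~-refl
fromPoly-^ p (suc n) =
  ~-trans (*ₚ-nonzero oneₚ-nonzero oneₚ-nonzero)
          (*F-cong (~-refl {fromPoly p}) (fromPoly-^ p n)) (fromPoly-* p (p ^ₚ n))

spineLabel : Poly → ℕ → Frac
spineLabel q n = frac (fib q n) (fib q (suc n))

-- The product of reciprocal labels collected by the climb from the j-th vertex of the
-- (m-1)-st branch of the root up to the root itself.
spineProduct : Poly → ℕ → Frac
spineProduct q zero = oneF
spineProduct q (suc j) = invF (spineLabel q (suc j)) *F spineProduct q j

-- The middle factor oneF is the value p of the m-th child rule, which is 1 along the
-- m-th branch of a vertex of the (m-1)-st branch of the root when m ≥ 3.
lastStep : Poly → Frac → Frac
lastStep q x = oneF +F fromPoly q *F oneF *F x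

lastReciprocal : Poly → ℕ → ℕ → Frac
lastReciprocal q j zero = spineProduct q j
lastReciprocal q j (suc i) = lastStep q (lastReciprocal q j i)

spineProduct-fib : ∀ q j → spineProduct q j ~ fromPoly (fib q (suc j))
spineProduct-fib q zero = ~-refl
spineProduct-fib q (suc j) = mk~ (begin
  (f₂ *ₚ num P) *ₚ oneₚ          ≈⟨ *ₚ-assoc f₂ (num P) oneₚ ⟩
  f₂ *ₚ (num P *ₚ oneₚ)          ≈⟨ *ₚ-cong (≈-refl {f₂}) (cross (spineProduct-fib q j)) ⟩
  f₂ *ₚ (fib q (suc j) *ₚ den P) ∎)
  where
  open ≈-Reasoning
  f₂ : Poly
  f₂ = fib q (suc (suc j))
  P : Frac
  P = spineProduct q j

-- Labels located through the level-order numbering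

if-T : ∀ {A : Set} {b} {x y : A} → T b → (if b then x else y) ≡ x
if-T {b = true} _ = refl

if-¬T : ∀ {A : Set} {b} {x y : A} → ¬ T b → (if b then x else y) ≡ y
if-¬T {b = false} _ = refl
if-¬T {b = true} ¬t = ⊥-elim (¬t _)

≢⇒¬T≡ᵇ : ∀ m n → m ≢ n → ¬ T (m ≡ᵇ n)
≢⇒¬T≡ᵇ m n m≢n t = m≢n (≡ᵇ⇒≡ m n t)

≤⇒¬T<ᵇ : ∀ m n → n ≤ m → ¬ T (m <ᵇ n)
≤⇒¬T<ᵇ m n n≤m t = <⇒≱ (<ᵇ⇒< m n t) n≤m

iter-+ : ∀ h i j (x : ℕ) → iter h i (iter h j x) ≡ iter h (i + j) x
iter-+ h zero j x = refl
iter-+ h (suc i) j x = cong h (iter-+ h i j x)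

module CalkinWilfTree (k : ℕ) (q : Poly) where
  open Tree k q

  child-% : ∀ v c → c < m → (m * v + c) % m ≡ c
  child-% v c c<m = begin
    (m * v + c) % m   ≡⟨ cong (_% m) (+-comm (m * v) c) ⟩
    (c + m * v) % m   ≡⟨ cong (λ n → (c + n) % m) (*-comm m v) ⟩
    (c + v * m) % m   ≡⟨ [m+kn]%n≡m%n c v m ⟩
    c % m             ≡⟨ m<n⇒m%n≡m c<m ⟩
    c                 ∎
    where open ≡-Reasoning

  child-/ : ∀ v c → c < m → (m * v + c) / m ≡ v
  child-/ v c c<m = begin
    (m * v + c) / m       ≡⟨ cong (λ n → (n + c) / m) (*-comm m v) ⟩
    (v * m + c) / m       ≡⟨ +-distrib-/-∣ˡ c (divides-refl v) ⟩
    v * m / m + c / m     ≡⟨ cong₂ _+_ (m*n/n≡m v m) (m<n⇒m/n≡0 c<m) ⟩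
    v + 0                 ≡⟨ +-identityʳ v ⟩
    v                     ∎
    where open ≡-Reasoning

  labelF-child : ∀ f v c → c < m → labelF (suc f) (child m (suc c) v) ≡ childLabel f c v
  labelF-child f v c c<m rewrite +-suc (m * v) c = cong₂ (childLabel f) (child-% v c c<m) (child-/ v c c<m)

  k<m : k < m
  k<m = n≤1+n (suc k)

  labelF-early-child : ∀ f v c → c < k → labelF (suc f) (child m (suc c) v) ≡ frac oneₚ (oneₚ +ₚ q)
  labelF-early-child f v c c<k =
    trans (labelF-child f v c (<-trans c<k k<m)) (if-T (<⇒<ᵇ c<k))

  labelF-penultimate-child : ∀ f v → labelF (suc f) (child m (suc k) v) ≡ cwStep (labelF f v)
  labelF-penultimate-child f v =
    trans (labelF-child f v k k<m)
          (trans (if-¬T (≤⇒¬T<ᵇ k k ≤-refl)) (if-T (≡⇒≡ᵇ k k refl)))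

  labelF-last-child : ∀ f v → labelF (suc f) (child m m v) ≡ mthLabel f v
  labelF-last-child f v =
    trans (labelF-child f v (suc k) ≤-refl)
          (trans (if-¬T (≤⇒¬T<ᵇ (suc k) k (n≤1+n k))) (if-¬T (≢⇒¬T≡ᵇ (suc k) k 1+n≢n)))

  labelF-root : ∀ f → labelF f 0 ≡ oneF
  labelF-root zero = refl
  labelF-root (suc f) = refl

  n<child : ∀ c n → n < child m (suc c) n
  n<child c n rewrite +-suc (m * n) c = s≤s (≤-trans (m≤m+n n (suc k * n)) (m≤m+n (m * n) c))

  iter-child-≥ : ∀ c i n → i + n ≤ iter (child m (suc c)) i n
  iter-child-≥ c zero n = ≤-refl
  iter-child-≥ c (suc i) n = ≤-trans (s≤s (iter-child-≥ c i n)) (n<child c (iter (child m (suc c)) i n))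

  spine : ℕ → ℕ
  spine j = iter (child m (suc k)) j 0

  labelF-spine : ∀ j f → j ≤ f → labelF f (spine j) ≡ spineLabel q j
  labelF-spine zero f _ = labelF-root f
  labelF-spine (suc j) (suc f) (s≤s j≤f) =
    trans (labelF-penultimate-child f (spine j)) (cong cwStep (labelF-spine j f j≤f))

  climb-penultimate-child : ∀ f g v → climb f (suc g) (child m (suc k) v)
    ≡ (invF (labelF f (child m (suc k) v)) *F proj₁ (climb f g v) , proj₂ (climb f g v))
  climb-penultimate-child f g v
    rewrite +-suc (m * v) k | child-% v k k<m | child-/ v k k<m = if-T (≡⇒≡ᵇ k k refl)

  climb-last-child : ∀ f g v → climb f (suc g) (child m m v) ≡ (invF (labelF f (child m m v)) , child m m v)
  climb-last-child f g v
    rewrite +-suc (m * v) (suc k) | child-% v (suc k) ≤-refl = if-¬T (≢⇒¬T≡ᵇ (suc k) k 1+n≢n)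

  climb-spine : ∀ j f g → j ≤ f → j ≤ g → climb f g (spine j) ≡ (spineProduct q j , 0)
  climb-spine zero f g _ _ = cong (λ l → invF l , 0) (labelF-root f)
  climb-spine (suc j) f (suc g) j<f (s≤s j≤g) =
    trans (climb-penultimate-child f g (spine j))
          (cong₂ (λ l c → invF l *F proj₁ c , proj₂ c)
                 (labelF-spine (suc j) f j<f) (climb-spine j f g (≤-trans (n≤1+n j) j<f) j≤g))

  mthLabel-spine : ∀ j f → j ≤ f → mthLabel f (spine j) ≡ invF (lastStep q (spineProduct q j))
  mthLabel-spine j f j≤f = cong (λ c → invF (oneF +F qF *F pValue f (proj₂ c) *F proj₁ c))
                               (climb-spine j f (suc f) j≤f (m≤n⇒m≤1+n j≤f))

  label-spine : ∀ j → label (spine j) ≡ spineLabel q j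
  label-spine j = labelF-spine j (suc (spine j)) (m≤n⇒m≤1+n (≤-trans (m≤m+n j 0) (iter-child-≥ k j 0)))

  label-penultimateBranch : ∀ j i → label (iter (child m (suc k)) i (spine j)) ≡ spineLabel q (j + i)
  label-penultimateBranch j i = begin
    label (iter (child m (suc k)) i (spine j))   ≡⟨ cong label (iter-+ (child m (suc k)) i j 0) ⟩
    label (spine (i + j))                        ≡⟨ label-spine (i + j) ⟩
    spineLabel q (i + j)                         ≡⟨ cong (spineLabel q) (+-comm i j) ⟩
    spineLabel q (j + i)                         ∎
    where open ≡-Reasoning

  label-early-child : ∀ c v → c < k → label (child m (suc c) v) ≡ frac oneₚ (oneₚ +ₚ q)
  label-early-child c v = labelF-early-child (child m (suc c) v) v c

module CalkinWilfTree₃ (k : ℕ) (q : Poly) where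
  open Tree (suc k) q
  open CalkinWilfTree (suc k) q

  pValue-last-child : ∀ f v → pValue f (child m m v) ≡ oneF
  pValue-last-child f v rewrite +-suc (m * v) (suc (suc k)) | child-% v (suc (suc k)) ≤-refl =
    if-¬T (≢⇒¬T≡ᵇ (suc (suc k)) k (>⇒≢ (m≤n⇒m≤1+n (n<1+n k))))

  mthLabel-last-child : ∀ f v → mthLabel f (child m m v) ≡ invF (lastStep q (invF (labelF f (child m m v))))
  mthLabel-last-child f v rewrite climb-last-child f f v | pValue-last-child f v = refl

  lastBranch : ℕ → ℕ → ℕ
  lastBranch j i = iter (child m m) i (spine j)

  mthLabel-lastBranch : ∀ j i f → i + j ≤ f →
    mthLabel f (lastBranch j i) ≡ invF (lastReciprocal q j (suc i))
  mthLabel-lastBranch j zero f j≤f = mthLabel-spine j f j≤f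
  mthLabel-lastBranch j (suc i) (suc f) (s≤s i+j≤f) =
    trans (mthLabel-last-child (suc f) (lastBranch j i))
          (cong (λ l → invF (lastStep q (invF l)))
                (trans (labelF-last-child f (lastBranch j i)) (mthLabel-lastBranch j i f i+j≤f)))

  label-lastBranch : ∀ j i → label (lastBranch j (suc i)) ≡ invF (lastReciprocal q j (suc i))
  label-lastBranch j i = trans (labelF-last-child n (lastBranch j i)) (mthLabel-lastBranch j i n i+j≤n)
    where
    n : ℕ
    n = lastBranch j (suc i)
    i+j≤n : i + j ≤ n
    i+j≤n = ≤-trans (+-monoʳ-≤ i (≤-trans (m≤m+n j 0) (iter-child-≥ (suc k) j 0)))
              (≤-trans (iter-child-≥ (suc (suc k)) i (spine j))
                       (<⇒≤ (n<child (suc (suc k)) (lastBranch j i))))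

-- Evaluation at q = -s²

+qₛ*-coeff₀ : ∀ p r → coeff (p +ₚ qₛ *ₚ r) 0 ≡ coeff p 0
+qₛ*-coeff₀ p r =
  trans (coeff-+ p (qₛ *ₚ r) 0)
        (trans (cong (λ c → coeff p 0 ℤ.+ c) (coeff₀-* qₛ r)) (ℤ.+-identityʳ (coeff p 0)))

fib-coeff₀ : ∀ n → coeff (fib qₛ n) 0 ≡ 1ℤ
fib-coeff₀ zero = refl
fib-coeff₀ (suc zero) = refl
fib-coeff₀ (suc (suc n)) = trans (+qₛ*-coeff₀ (fib qₛ (suc n)) (fib qₛ n)) (fib-coeff₀ (suc n))

fib-nonzero : ∀ n → Nonzero (fib qₛ n)
fib-nonzero n = coeff₀-one⇒nonzero (fib-coeff₀ n)

Xₚ-nonzero : Nonzero Xₚ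
Xₚ-nonzero = nonzero-at 1 λ ()

xₛ-wellFormed : WellFormed xₛ
xₛ-wellFormed = nonzero-at 1 λ ()

chebU-wellFormed : ∀ n → WellFormed (chebU n xₛ)
chebU-wellFormed zero = oneₚ-nonzero
chebU-wellFormed (suc zero) = *ₚ-nonzero oneₚ-nonzero xₛ-wellFormed
chebU-wellFormed (suc (suc n)) =
  *ₚ-nonzero (*ₚ-nonzero (*ₚ-nonzero oneₚ-nonzero xₛ-wellFormed) (chebU-wellFormed (suc n)))
             (chebU-wellFormed n)

chebU-fib : ∀ n → chebU n xₛ ~ frac (fib qₛ n) (Xₚ ^ₚ n)
chebU-fib zero = ~-refl
chebU-fib (suc zero) = mk~ (U₁ Xₚ)
  where
  U₁ : ∀ X → ((oneₚ +ₚ oneₚ) *ₚ (oneₚ *ₚ oneₚ)) *ₚ (X *ₚ oneₚ)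
             ≈ oneₚ *ₚ (oneₚ *ₚ ((oneₚ +ₚ oneₚ) *ₚ X))
  U₁ = solve-∀ ℤ[X]-almost
chebU-fib (suc (suc n)) =
  ~-trans (*ₚ-nonzero (*ₚ-nonzero (*ₚ-nonzero oneₚ-nonzero xₛ-wellFormed) (^ₚ-nonzero (suc n) Xₚ-nonzero))
                      (^ₚ-nonzero n Xₚ-nonzero))
          (-F-cong (*F-cong (~-refl {fromPoly (+ 2 ∷ []) *F xₛ}) (chebU-fib (suc n))) (chebU-fib n))
          (mk~ (recurrence Xₚ (fib qₛ (suc n)) (fib qₛ n) (Xₚ ^ₚ n)))
  where
  recurrence : ∀ X A₁ A₀ Xⁿ →
    (((((oneₚ +ₚ oneₚ) *ₚ (oneₚ *ₚ oneₚ)) *ₚ A₁) *ₚ Xⁿ)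
       +ₚ negₚ A₀ *ₚ ((oneₚ *ₚ ((oneₚ +ₚ oneₚ) *ₚ X)) *ₚ (X *ₚ Xⁿ)))
      *ₚ (X *ₚ (X *ₚ Xⁿ))
    ≈ (A₁ +ₚ negₚ (X *ₚ X) *ₚ A₀) *ₚ (((oneₚ *ₚ ((oneₚ +ₚ oneₚ) *ₚ X)) *ₚ (X *ₚ Xⁿ)) *ₚ Xⁿ)
  recurrence = solve-∀ ℤ[X]-almost

chebU-num-nonzero : ∀ n → Nonzero (num (chebU n xₛ))
chebU-num-nonzero n = ~-num-nonzero (chebU-fib n) (chebU-wellFormed n) (fib-nonzero n)

ratioU-wellFormed : ∀ n → WellFormed (ratioU n)
ratioU-wellFormed n = *ₚ-nonzero (chebU-wellFormed n) (*ₚ-nonzero Xₚ-nonzero (chebU-num-nonzero (suc n)))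

ratioU-fib : ∀ n → ratioU n ~ frac (fib qₛ n) (fib qₛ (suc n))
ratioU-fib n =
  ~-trans (*ₚ-nonzero (^ₚ-nonzero n Xₚ-nonzero) (*ₚ-nonzero Xₚ-nonzero (fib-nonzero (suc n))))
          (*F-cong (chebU-fib n) (invF-cong (*F-cong (~-refl {sF}) (chebU-fib (suc n)))))
          (mk~ (cancel Xₚ (fib qₛ n) (fib qₛ (suc n)) (Xₚ ^ₚ n)))
  where
  cancel : ∀ X A₀ A₁ Xⁿ → (A₀ *ₚ (oneₚ *ₚ (X *ₚ Xⁿ))) *ₚ A₁ ≈ A₀ *ₚ (Xⁿ *ₚ (X *ₚ A₁))
  cancel = solve-∀ ℤ[X]-almost

tVal-fib : ∀ j → tVal j ~ fromPoly (fib qₛ (suc j))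
tVal-fib j =
  ~-trans (*ₚ-nonzero oneₚ-nonzero (^ₚ-nonzero (suc j) Xₚ-nonzero))
          (*F-cong (fromPoly-^ Xₚ (suc j)) (chebU-fib (suc j)))
          (mk~ (cancel (Xₚ ^ₚ suc j) (fib qₛ (suc j))))
  where
  cancel : ∀ Xⁿ A → (Xⁿ *ₚ A) *ₚ oneₚ ≈ A *ₚ (oneₚ *ₚ Xⁿ)
  cancel = solve-∀ ℤ[X]-almost

spineProduct-wellFormed : ∀ j → WellFormed (spineProduct qₛ j)
spineProduct-wellFormed zero = oneₚ-nonzero
spineProduct-wellFormed (suc j) = *ₚ-nonzero (fib-nonzero (suc j)) (spineProduct-wellFormed j)

lastPoly : ℕ → ℕ → Poly
lastPoly j i = geomₚ qₛ i +ₚ qₛ ^ₚ i *ₚ fib qₛ (suc j)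

lastPoly-suc : ∀ j i → lastPoly j (suc i) ≈ oneₚ +ₚ qₛ *ₚ lastPoly j i
lastPoly-suc j i =
  ≈-trans (+ₚ-cong (geomₚ-suc qₛ i) ≈-refl) (distrib qₛ (geomₚ qₛ i) (qₛ ^ₚ i) (fib qₛ (suc j)))
  where
  distrib : ∀ q g r a → (oneₚ +ₚ q *ₚ g) +ₚ (q *ₚ r) *ₚ a ≈ oneₚ +ₚ q *ₚ (g +ₚ r *ₚ a)
  distrib = solve-∀ ℤ[X]-almost

lastPoly-nonzero : ∀ j i → Nonzero (lastPoly j (suc i))
lastPoly-nonzero j i e =
  coeff₀-one⇒nonzero (+qₛ*-coeff₀ oneₚ (lastPoly j i)) (≈-trans (≈-sym (lastPoly-suc j i)) e)

lastReciprocal-wellFormed : ∀ j i → WellFormed (lastReciprocal qₛ j i)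
lastReciprocal-wellFormed j zero = spineProduct-wellFormed j
lastReciprocal-wellFormed j (suc i) =
  *ₚ-nonzero oneₚ-nonzero
    (*ₚ-nonzero (*ₚ-nonzero oneₚ-nonzero oneₚ-nonzero) (lastReciprocal-wellFormed j i))

lastStep-fromPoly : ∀ q g → lastStep q (fromPoly g) ~ fromPoly (oneₚ +ₚ q *ₚ g)
lastStep-fromPoly q g = mk~ (clear-denominators q g)
  where
  clear-denominators : ∀ q g → (oneₚ *ₚ ((oneₚ *ₚ oneₚ) *ₚ oneₚ) +ₚ ((q *ₚ oneₚ) *ₚ g) *ₚ oneₚ) *ₚ oneₚ
                  ≈ (oneₚ +ₚ q *ₚ g) *ₚ (oneₚ *ₚ ((oneₚ *ₚ oneₚ) *ₚ oneₚ))
  clear-denominators = solve-∀ ℤ[X]-almost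

lastReciprocal-lastPoly : ∀ j i → lastReciprocal qₛ j i ~ fromPoly (lastPoly j i)
lastReciprocal-lastPoly j zero =
  ~-trans oneₚ-nonzero (spineProduct-fib qₛ j) (fromPoly-cong (≈-sym (*ₚ-identityˡ (fib qₛ (suc j)))))
lastReciprocal-lastPoly j (suc i) =
  ~-trans (*ₚ-nonzero oneₚ-nonzero (*ₚ-nonzero (*ₚ-nonzero oneₚ-nonzero oneₚ-nonzero) oneₚ-nonzero))
    (+F-cong (~-refl {oneF}) (*F-cong (~-refl {qsF *F oneF}) (lastReciprocal-lastPoly j i)))
    (~-trans oneₚ-nonzero (lastStep-fromPoly qₛ (lastPoly j i)) (fromPoly-cong (≈-sym (lastPoly-suc j i))))

geomF-wellFormed : ∀ i → WellFormed (geomF i)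
geomF-wellFormed zero = oneₚ-nonzero
geomF-wellFormed (suc i) = *ₚ-nonzero (geomF-wellFormed i) (^F-wellFormed i oneₚ-nonzero)

geomF-geomₚ : ∀ i → geomF i ~ fromPoly (geomₚ qₛ i)
geomF-geomₚ zero = ~-refl
geomF-geomₚ (suc i) =
  ~-trans (*ₚ-nonzero oneₚ-nonzero oneₚ-nonzero) (+F-cong (geomF-geomₚ i) (fromPoly-^ qₛ i))
          (fromPoly-+ (geomₚ qₛ i) (qₛ ^ₚ i))

lastValue : ℕ → ℕ → Frac
lastValue j i = geomF i +F (qsF ^F i) *F tVal j

lastValue-wellFormed : ∀ j i → WellFormed (lastValue j i)
lastValue-wellFormed j i =
  *ₚ-nonzero (geomF-wellFormed i)
    (*ₚ-nonzero (^F-wellFormed i oneₚ-nonzero)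
                (*ₚ-nonzero (^F-wellFormed (suc j) oneₚ-nonzero) (chebU-wellFormed (suc j))))

lastValue-lastPoly : ∀ j i → lastValue j i ~ fromPoly (lastPoly j i)
lastValue-lastPoly j i =
  ~-trans (*ₚ-nonzero oneₚ-nonzero (*ₚ-nonzero oneₚ-nonzero oneₚ-nonzero))
          (+F-cong (geomF-geomₚ i) (*F-cong (fromPoly-^ qₛ i) (tVal-fib j)))
          (mk~ (clear-denominators (geomₚ qₛ i) (qₛ ^ₚ i) (fib qₛ (suc j))))
  where
  clear-denominators : ∀ g r a → (g *ₚ (oneₚ *ₚ oneₚ) +ₚ (r *ₚ a) *ₚ oneₚ) *ₚ oneₚ
                    ≈ (g +ₚ r *ₚ a) *ₚ (oneₚ *ₚ (oneₚ *ₚ oneₚ))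
  clear-denominators = solve-∀ ℤ[X]-almost

spineLabel≃ratioU : ∀ n → spineLabel qₛ n ≃ ratioU n
spineLabel≃ratioU n = ~⇒≃ (fib-nonzero (suc n)) (ratioU-wellFormed n) (~-sym (ratioU-fib n))

earlyLabel≃ : frac oneₚ (oneₚ +ₚ qₛ) ≃ invF (oneF +F qsF)
earlyLabel≃ = ~⇒≃ {frac oneₚ (oneₚ +ₚ qₛ)} {invF (oneF +F qsF)}
  (coeff₀-one⇒nonzero refl) (coeff₀-one⇒nonzero refl) (mk~ (clear-denominators qₛ))
  where
  clear-denominators : ∀ q → oneₚ *ₚ (oneₚ *ₚ oneₚ +ₚ q *ₚ oneₚ) ≈ (oneₚ *ₚ oneₚ) *ₚ (oneₚ +ₚ q)
  clear-denominators = solve-∀ ℤ[X]-almost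

lastLabel≃ : ∀ j i → invF (lastReciprocal qₛ j (suc i)) ≃ invF (lastValue j (suc i))
lastLabel≃ j i =
  ~⇒≃ (~-num-nonzero R~ (lastReciprocal-wellFormed j (suc i)) (lastPoly-nonzero j i))
      (~-num-nonzero T~ (lastValue-wellFormed j (suc i)) (lastPoly-nonzero j i))
      (invF-cong (~-trans oneₚ-nonzero R~ (~-sym T~)))
  where
  R~ = lastReciprocal-lastPoly j (suc i)
  T~ = lastValue-lastPoly j (suc i)

module Branches (k : ℕ) where
  open Tree k qₛ using (m; label)
  open CalkinWilfTree k qₛ

  penultimateBranch-labels : ∀ j i → label (iter (child m (suc k)) i (spine j)) ≃ ratioU (j + i)
  penultimateBranch-labels j i =
    subst (_≃ ratioU (j + i)) (sym (label-penultimateBranch j i)) (spineLabel≃ratioU (j + i))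

module Branches₃ (k : ℕ) where
  open Tree (suc k) qₛ using (m; label)
  open CalkinWilfTree (suc k) qₛ
  open CalkinWilfTree₃ k qₛ

  earlyBranch-labels : ∀ j c → 1 ≤ c → c ≤ suc k → ∀ i →
    label (iter (child m c) (suc i) (spine j)) ≃ invF (oneF +F qsF)
  earlyBranch-labels j (suc c) _ c≤k i =
    subst (_≃ invF (oneF +F qsF)) (sym (label-early-child c (iter (child m (suc c)) i (spine j)) c≤k))
          earlyLabel≃

  lastBranch-labels : ∀ j i → label (lastBranch j (suc i)) ≃ invF (lastValue j (suc i))
  lastBranch-labels j i = subst (_≃ invF (lastValue j (suc i))) (sym (label-lastBranch j i)) (lastLabel≃ j i)

mainTheorem4 : (m : ℕ) → 2 ≤ m → (j : ℕ) →
    ((i : ℕ) → cwLabel m qₛ (iter (child m (m ∸ 1)) i (iter (child m (m ∸ 1)) j 0)) ≃ ratioU (j + i))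
    × (3 ≤ m →
        ((c : ℕ) → 1 ≤ c → c ≤ m ∸ 2 → (i : ℕ) →
          cwLabel m qₛ (iter (child m c) (suc i) (iter (child m (m ∸ 1)) j 0)) ≃ invF (oneF +F qsF))
        × ((i : ℕ) →
          cwLabel m qₛ (iter (child m m) (suc i) (iter (child m (m ∸ 1)) j 0))
            ≃ invF (geomF (suc i) +F (qsF ^F suc i) *F tVal j)))
mainTheorem4 (suc zero) (s≤s ()) j
mainTheorem4 (suc (suc zero)) _ j = Branches.penultimateBranch-labels 0 j , λ { (s≤s (s≤s ())) }
mainTheorem4 (suc (suc (suc k))) _ j =
  Branches.penultimateBranch-labels (suc k) j ,
  λ _ → Branches₃.earlyBranch-labels k j , Branches₃.lastBranch-labels k j
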